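{- Let $(G, \phi, (g_1, \dots, g_n))$ be an $n$-expansion group. Then $((L_{\bullet}(G), [\,,]_{G}), L_{\bullet}(\phi))$ is an $n$-expansion Lie algebra.
   Context: $V_{[n]} = \mathbb{F}_2^n$ with standard basis $e_1,\dots,e_n$. Commutators in groups: $[x,y]=xyx^{ -1}y^{ -1}$. An $n$-expansion group is a triple $(G,\phi,(g_1,\dots,g_n))$ where $G$ is a group, $\phi: G\to V_{[n]}$ is a homomorphism, $g_i\in G$ with $\phi(g_i)=e_i$, $\ker\phi$ is an elementary abelian $2$-group, $[G,G]=\ker\phi$, and $g_i^2=1$ for all $i$. For a group $G$, $G^{(1)}=G$, $G^{(i+1)}=[G,G^{(i)}]$; $L_m(G)=G^{(m)}/G^{(m+1)}$ and $L_\bullet(G)=\bigoplus_{m\ge1}L_m(G)$ with the graded Lie bracket $[\,,]_G$ induced by group commutators; a homomorphism $\phi$ induces a graded Lie algebra homomorphism $L_\bullet(\phi)$ (here $V_{[n]}$ is viewed as an abelian graded Lie algebra concentrated in degree $1$). A graded Lie algebra over $\mathbb{F}_2$ is $L_\bullet=\bigoplus_{m\ge1}L_m$ with $[L_h,L_k]\subseteq L_{h+k}$. An $n$-expansion Lie algebra is a pair $(L_\bullet,\psi)$ where: (1) $L_\bullet$ is a graded Lie algebra over $\mathbb{F}_2$ and $\psi:L_\bullet\to V_{[n]}$ is a surjective graded Lie algebra homomorphism; (2) $\ker\psi$ is an abelian subalgebra; (3) $[L_\bullet,L_\bullet]=\ker\psi$; (4) for each $i\ge4$ and $\sigma_1,\dots,\sigma_i\in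 L_1$, the commutator $[\sigma_1,[\sigma_2,[\dots,[\sigma_{i-1},\sigma_i]\dots]]]$ does not depend on the order of the first $i-2$ entries and vanishes whenever $\sigma_s=\sigma_t$ for distinct $s,t\in[i-2]$; moreover if $\tau_1,\tau_2\in L_1$ with $\psi(\tau_1)\in\{e_1,\dots,e_n\}$ then $[\tau_1,[\tau_1,\tau_2]]=0$. -}

module Defs where

open import Level using (Level; _⊔_; Lift)
open import Data.Nat using (ℕ; zero; suc; _+_)
open import Data.Fin using (Fin) renaming (zero to fzero; suc to fsuc; _≟_ to _≟ᶠ_)
open import Data.Fin.Permutation using (Permutation; _⟨$⟩ʳ_)
open import Data.Bool using (Bool; false; _xor_)
open import Data.Vec using (Vec; zipWith; replicate; tabulate)
open import Data.Product using (Σ; ∃; ∃-syntax; _×_; _,_)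
open import Data.Empty using (⊥)
open import Data.Unit.Polymorphic using (⊤)
open import Relation.Nullary.Decidable using (⌊_⌋)
open import Relation.Binary.PropositionalEquality using (_≡_; _≢_)
open import Algebra.Bundles using (Group)

-- V_[n] = F_2^n  (F_2 = Bool, addition = xor)

V : ℕ → Set
V n = Vec Bool n

_⊕_ : ∀ {n} → V n → V n → V n
_⊕_ = zipWith _xor_

𝟎 : ∀ n → V n
𝟎 n = replicate n false

e : ∀ {n} → Fin n → V n
e i = tabulate (λ j → ⌊ i ≟ᶠ j ⌋)

module GroupDefs {c ℓ} (G : Group c ℓ) where
  open Group G

  ⟦_,_⟧ : Carrier → Carrier → Carrier
  ⟦ x , y ⟧ = x ∙ y ∙ x ⁻¹ ∙ y ⁻¹

  data Gen (P : Carrier → Set (c ⊔ ℓ)) : Carrier → Set (c ⊔ ℓ) where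
    base : ∀ {x} → P x → Gen P x
    unit : Gen P ε
    mul  : ∀ {x y} → Gen P x → Gen P y → Gen P (x ∙ y)
    inv  : ∀ {x} → Gen P x → Gen P (x ⁻¹)
    resp : ∀ {x y} → x ≈ y → Gen P x → Gen P y

  CommSub : (Carrier → Set (c ⊔ ℓ)) → Carrier → Set (c ⊔ ℓ)
  CommSub H = Gen (λ z → ∃[ x ] ∃[ y ] (H y × z ≈ ⟦ x , y ⟧))

  Whole : Carrier → Set (c ⊔ ℓ)
  Whole _ = ⊤

  -- lower central series: LCS m = G^(m) for m ≥ 1
  -- (G^(1) = G, G^(m+1) = [G, G^(m)]; the index 0 is unused and set to G)
  LCS : ℕ → Carrier → Set (c ⊔ ℓ)
  LCS zero = Whole
  LCS (suc zero) = Whole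
  LCS (suc (suc m)) = CommSub (LCS (suc m))

  -- L_m(G) = G^(m)/G^(m+1), presented on raw elements of G by the
  -- partial equivalence relation  x ~_m y  iff x,y ∈ G^(m) and x y⁻¹ ∈ G^(m+1).
  -- Addition is induced by the group product, zero by ε, the bracket by ⟦_,_⟧.
  LEq : ℕ → Carrier → Carrier → Set (c ⊔ ℓ)
  LEq m x y = LCS m x × LCS m y × LCS (suc m) (x ∙ y ⁻¹)

  record IsNExpansionGroup (n : ℕ) (φ : Carrier → V n) (g : Fin n → Carrier) : Set (c ⊔ ℓ) where
    field
      φ-cong    : ∀ {x y} → x ≈ y → φ x ≡ φ y
      φ-hom     : ∀ x y → φ (x ∙ y) ≡ φ x ⊕ φ y
      φ-gen     : ∀ i → φ (g i) ≡ e i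
      ker-comm  : ∀ x y → φ x ≡ 𝟎 n → φ y ≡ 𝟎 n → x ∙ y ≈ y ∙ x
      ker-exp2  : ∀ x → φ x ≡ 𝟎 n → x ∙ x ≈ ε
      derived⊆ker : ∀ x → CommSub Whole x → φ x ≡ 𝟎 n
      ker⊆derived : ∀ x → φ x ≡ 𝟎 n → CommSub Whole x
      g-invol   : ∀ i → g i ∙ g i ≈ ε

-- Graded Lie algebras over F_2, presented on a raw carrier A with a
-- degree-indexed partial equivalence relation Eq m (m ≥ 1):
--   L_m = { x : A | Eq m x x } / Eq m.
-- Addition, zero and bracket are raw operations required to respect
-- the relations; the bracket maps L_h × L_k into L_(h+k).
-- Only positive degrees (suc _) are constrained.

module LieDefs {a ℓ} {A : Set a} (Eq : ℕ → A → A → Set ℓ)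
               (_⊞_ : A → A → A) (0# : A) (br : A → A → A) where

  data Span : ℕ → A → Set (a ⊔ ℓ) where
    bracket : ∀ {h k m x y} → suc h + suc k ≡ m →
              Eq (suc h) x x → Eq (suc k) y y → Span m (br x y)
    zero    : ∀ {m} → Span m 0#
    plus    : ∀ {m x y} → Span m x → Span m y → Span m (x ⊞ y)
    resp    : ∀ {m x y} → Span m x → Eq m x y → Span m y

  nest : ∀ {k} → (Fin k → A) → A → A → A
  nest {zero}  σ a b = br a b
  nest {suc k} σ a b = br (σ fzero) (nest (λ i → σ (fsuc i)) a b)

  record IsGradedLieAlgebra₂ : Set (a ⊔ ℓ) where
    field
      ≈-sym       : ∀ {m x y} → Eq (suc m) x y → Eq (suc m) y x
      ≈-trans     : ∀ {m x y z} → Eq (suc m) x y → Eq (suc m) y z → Eq (suc m) x z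
      0-valid     : ∀ m → Eq (suc m) 0# 0#
      +-cong      : ∀ {m x x' y y'} → Eq (suc m) x x' → Eq (suc m) y y' →
                    Eq (suc m) (x ⊞ y) (x' ⊞ y')
      +-assoc     : ∀ {m x y z} → Eq (suc m) x x → Eq (suc m) y y → Eq (suc m) z z →
                    Eq (suc m) ((x ⊞ y) ⊞ z) (x ⊞ (y ⊞ z))
      +-comm      : ∀ {m x y} → Eq (suc m) x x → Eq (suc m) y y →
                    Eq (suc m) (x ⊞ y) (y ⊞ x)
      +-identityʳ : ∀ {m x} → Eq (suc m) x x → Eq (suc m) (x ⊞ 0#) x
      +-self      : ∀ {m x} → Eq (suc m) x x → Eq (suc m) (x ⊞ x) 0#
      br-cong     : ∀ {h k x x' y y'} → Eq (suc h) x x' → Eq (suc k) y y' →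
                    Eq (suc h + suc k) (br x y) (br x' y')
      br-distribʳ : ∀ {h k x x' y} → Eq (suc h) x x → Eq (suc h) x' x' → Eq (suc k) y y →
                    Eq (suc h + suc k) (br (x ⊞ x') y) (br x y ⊞ br x' y)
      br-distribˡ : ∀ {h k x y y'} → Eq (suc h) x x → Eq (suc k) y y → Eq (suc k) y' y' →
                    Eq (suc h + suc k) (br x (y ⊞ y')) (br x y ⊞ br x y')
      -- alternating (on the direct sum: [x,x] = 0 and [x,y] = [y,x] in char 2)
      br-self     : ∀ {h x} → Eq (suc h) x x → Eq (suc h + suc h) (br x x) 0#
      br-anticomm : ∀ {h k x y} → Eq (suc h) x x → Eq (suc k) y y →
                    Eq (suc h + suc k) (br x y) (br y x)
      jacobi      : ∀ {h k l x y z} → Eq (suc h) x x → Eq (suc k) y y → Eq (suc l) z z →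
                    Eq (suc h + suc k + suc l)
                       ((br x (br y z) ⊞ br y (br z x)) ⊞ br z (br x y)) 0#

  module _ {n : ℕ} (ψ : A → V n) where

    -- ker ψ in degree m (V_[n] is concentrated in degree 1)
    Ker : ℕ → A → Set ℓ
    Ker zero          x = Lift ℓ ⊥
    Ker (suc zero)    x = Eq 1 x x × ψ x ≡ 𝟎 n
    Ker (suc (suc m)) x = Eq (suc (suc m)) x x

    record IsNExpansionLieAlgebra : Set (a ⊔ ℓ) where
      field
        isGradedLieAlgebra : IsGradedLieAlgebra₂
        -- (1) ψ : L_• → V_[n] surjective graded Lie algebra homomorphism
        --     (its components in degree ≥ 2 are 0; bracket-preservation is then automatic)
        ψ-cong : ∀ {x y} → Eq 1 x y → ψ x ≡ ψ y
        ψ-hom  : ∀ {x y} → Eq 1 x x → Eq 1 y y → ψ (x ⊞ y) ≡ ψ x ⊕ ψ y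
        ψ-surj : ∀ (v : V n) → ∃[ x ] (Eq 1 x x × ψ x ≡ v)
        ker-abelian : ∀ {h k x y} → Ker (suc h) x → Ker (suc k) y →
                      Eq (suc h + suc k) (br x y) 0#
        derived⊆ker : ∀ {m x} → Span (suc m) x → Ker (suc m) x
        ker⊆derived : ∀ {m x} → Ker (suc m) x → Span (suc m) x
        -- (4) for i = j + 4 ≥ 4 and σ_1..σ_i ∈ L_1 (σ = first i-2 entries, a = σ_(i-1), b = σ_i)
        nest-perm   : ∀ j (σ : Fin (suc (suc j)) → A) (a b : A) →
                      (∀ s → Eq 1 (σ s) (σ s)) → Eq 1 a a → Eq 1 b b →
                      (π : Permutation (suc (suc j)) (suc (suc j))) →
                      Eq (suc (suc (suc (suc j))))
                         (nest (λ s → σ (π ⟨$⟩ʳ s)) a b) (nest σ a b)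
        nest-repeat : ∀ j (σ : Fin (suc (suc j)) → A) (a b : A) →
                      (∀ s → Eq 1 (σ s) (σ s)) → Eq 1 a a → Eq 1 b b →
                      ∀ s t → s ≢ t → Eq 1 (σ s) (σ t) →
                      Eq (suc (suc (suc (suc j)))) (nest σ a b) 0#
        engel       : ∀ {τ₁ τ₂} → Eq 1 τ₁ τ₁ → Eq 1 τ₂ τ₂ →
                      (∃[ i ] ψ τ₁ ≡ e i) →
                      Eq 3 (br τ₁ (br τ₁ τ₂)) 0#

module Submission where

-- Write K = ker φ = [G,G].  The whole proof rests on three facts about K:
-- it is abelian, it has exponent 2, and it contains every square (since
-- V_[n] has exponent 2).  We isolate them in the record IsElementaryDerived
-- and derive from them alone that G acts on K through the abelian group
-- G/K of exponent 2; consequently iterated commutators [x,[y,c]] with c ∈ K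
-- are symmetric in x, y and vanish when x = y modulo K.  This yields exact
-- identities in G (Jacobi, anticommutativity, bilinearity up to terms of
-- higher degree), hence the graded Lie algebra axioms on G^(m)/G^(m+1), and
-- axiom (4): permutation invariance and vanishing of nested commutators.
-- Only surjectivity, the kernel in degree 1 and the Engel condition
-- [τ,[τ,-]] = 0 for lifts τ of basis vectors use φ and the generators g_i.

open import Level using (_⊔_)
open import Data.Nat using (ℕ; zero; suc; _+_)
open import Data.Nat.Properties using (+-suc; +-comm)
open import Data.Fin using (Fin) renaming (zero to fzero; suc to fsuc; _≟_ to _≟ᶠ_)
open import Data.Fin.Patterns using (0F; 1F; 2F; 3F)
open import Data.Fin.Permutation using (Permutation; _⟨$⟩ʳ_)
open import Data.Bool using (Bool; true; false; not)
open import Data.Bool.Properties using (xor-same; xor-identityˡ)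
open import Data.Vec using (Vec; []; _∷_; lookup; tabulate)
open import Data.Vec.Properties using (tabulate-cong; zipWith-identityˡ)
open import Data.List using (List; []; _∷_; _++_)
open import Data.List.Properties using (++-assoc; ++-identityʳ)
open import Data.Product using (∃-syntax; _×_; _,_; proj₁; proj₂)
open import Data.Empty using (⊥-elim)
open import Data.Unit.Polymorphic using (tt)
open import Relation.Nullary using (yes; no)
open import Relation.Nullary.Decidable using (⌊_⌋)
open import Relation.Binary.PropositionalEquality as ≡ using (_≡_; _≢_)
open import Algebra.Bundles using (Group; CommutativeMonoid)
import Algebra.Properties.CommutativeMonoid.Sum as CommutativeMonoidSum
open import Defs

-- Two expressions with the same normal form denote equal elements in every
-- group; this replaces long chains of associativity/inverse rewriting.
module GroupWord where

  data Expr (k : ℕ) : Set where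
    var : Fin k → Expr k
    one : Expr k
    _·_ : Expr k → Expr k → Expr k
    _⁻  : Expr k → Expr k

  infixl 7 _·_
  infix 8 _⁻

  x₀ : ∀ {k} → Expr (suc k)
  x₀ = var 0F
  x₁ : ∀ {k} → Expr (suc (suc k))
  x₁ = var 1F
  x₂ : ∀ {k} → Expr (suc (suc (suc k)))
  x₂ = var 2F
  x₃ : ∀ {k} → Expr (suc (suc (suc (suc k))))
  x₃ = var 3F

  [_,_]ₑ : ∀ {k} → Expr k → Expr k → Expr k
  [ s , t ]ₑ = s · t · s ⁻ · t ⁻

  conjₑ : ∀ {k} → Expr k → Expr k → Expr k
  conjₑ s t = s · t · s ⁻

  -- a letter (true , i) stands for xᵢ, (false , i) for xᵢ⁻¹
  Letter : ℕ → Set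
  Letter k = Bool × Fin k

  Word : ℕ → Set
  Word k = List (Letter k)

  consReduce : ∀ {k} → Letter k → Word k → Word k
  consReduce l [] = l ∷ []
  consReduce (true , i) ((true , j) ∷ w) = (true , i) ∷ (true , j) ∷ w
  consReduce (false , i) ((false , j) ∷ w) = (false , i) ∷ (false , j) ∷ w
  consReduce (true , i) ((false , j) ∷ w) with i ≟ᶠ j
  ... | yes _ = w
  ... | no _ = (true , i) ∷ (false , j) ∷ w
  consReduce (false , i) ((true , j) ∷ w) with i ≟ᶠ j
  ... | yes _ = w
  ... | no _ = (false , i) ∷ (true , j) ∷ w

  appendReduce : ∀ {k} → Word k → Word k → Word k
  appendReduce [] w = w
  appendReduce (l ∷ v) w = consReduce l (appendReduce v w)

  invertLetter : ∀ {k} → Letter k → Letter k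
  invertLetter (b , i) = (not b , i)

  invertWord : ∀ {k} → Word k → Word k
  invertWord [] = []
  invertWord (l ∷ w) = invertWord w ++ (invertLetter l ∷ [])

  normalise : ∀ {k} → Expr k → Word k
  normalise (var i) = (true , i) ∷ []
  normalise one = []
  normalise (s · t) = appendReduce (normalise s) (normalise t)
  normalise (s ⁻) = invertWord (normalise s)

module GroupWordSemantics {c ℓ} (G : Group c ℓ) where
  open Group G
  open GroupWord
  open import Relation.Binary.Reasoning.Setoid setoid
  open import Algebra.Properties.Group G using (⁻¹-anti-homo-∙; ⁻¹-involutive; ε⁻¹≈ε)

  module _ {k : ℕ} (ρ : Fin k → Carrier) where

    eval : Expr k → Carrier
    eval (var i) = ρ i
    eval one = ε
    eval (s · t) = eval s ∙ eval t
    eval (s ⁻) = eval s ⁻¹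

    evalLetter : Letter k → Carrier
    evalLetter (true , i) = ρ i
    evalLetter (false , i) = ρ i ⁻¹

    evalWord : Word k → Carrier
    evalWord [] = ε
    evalWord (l ∷ w) = evalLetter l ∙ evalWord w

    cancel : ∀ {x y} w → x ∙ y ≈ ε → evalWord w ≈ x ∙ (y ∙ evalWord w)
    cancel {x} {y} w xy≈ε = begin
      evalWord w             ≈⟨ identityˡ _ ⟨
      ε ∙ evalWord w         ≈⟨ ∙-congʳ xy≈ε ⟨
      x ∙ y ∙ evalWord w     ≈⟨ assoc _ _ _ ⟩
      x ∙ (y ∙ evalWord w)   ∎

    consReduce-sound : ∀ l w → evalWord (consReduce l w) ≈ evalLetter l ∙ evalWord w
    consReduce-sound l [] = refl
    consReduce-sound (true , i) ((true , j) ∷ w) = refl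
    consReduce-sound (false , i) ((false , j) ∷ w) = refl
    consReduce-sound (true , i) ((false , j) ∷ w) with i ≟ᶠ j
    ... | yes ≡.refl = cancel w (inverseʳ (ρ i))
    ... | no _ = refl
    consReduce-sound (false , i) ((true , j) ∷ w) with i ≟ᶠ j
    ... | yes ≡.refl = cancel w (inverseˡ (ρ i))
    ... | no _ = refl

    appendReduce-sound : ∀ v w → evalWord (appendReduce v w) ≈ evalWord v ∙ evalWord w
    appendReduce-sound [] w = sym (identityˡ _)
    appendReduce-sound (l ∷ v) w = begin
      evalWord (consReduce l (appendReduce v w)) ≈⟨ consReduce-sound l (appendReduce v w) ⟩
      evalLetter l ∙ evalWord (appendReduce v w)  ≈⟨ ∙-congˡ (appendReduce-sound v w) ⟩
      evalLetter l ∙ (evalWord v ∙ evalWord w)    ≈⟨ assoc _ _ _ ⟨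
      evalLetter l ∙ evalWord v ∙ evalWord w      ∎

    ++-sound : ∀ v w → evalWord (v ++ w) ≈ evalWord v ∙ evalWord w
    ++-sound [] w = sym (identityˡ _)
    ++-sound (l ∷ v) w = trans (∙-congˡ (++-sound v w)) (sym (assoc _ _ _))

    invertLetter-sound : ∀ l → evalLetter (invertLetter l) ≈ evalLetter l ⁻¹
    invertLetter-sound (true , i) = refl
    invertLetter-sound (false , i) = sym (⁻¹-involutive _)

    invertWord-sound : ∀ w → evalWord (invertWord w) ≈ evalWord w ⁻¹
    invertWord-sound [] = sym ε⁻¹≈ε
    invertWord-sound (l ∷ w) = begin
      evalWord (invertWord w ++ (invertLetter l ∷ []))          ≈⟨ ++-sound (invertWord w) _ ⟩
      evalWord (invertWord w) ∙ (evalLetter (invertLetter l) ∙ ε)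
        ≈⟨ ∙-cong (invertWord-sound w) (trans (identityʳ _) (invertLetter-sound l)) ⟩
      evalWord w ⁻¹ ∙ evalLetter l ⁻¹                          ≈⟨ ⁻¹-anti-homo-∙ _ _ ⟨
      (evalLetter l ∙ evalWord w) ⁻¹                            ∎

    normalise-sound : ∀ s → eval s ≈ evalWord (normalise s)
    normalise-sound (var i) = sym (identityʳ _)
    normalise-sound one = refl
    normalise-sound (s · t) =
      trans (∙-cong (normalise-sound s) (normalise-sound t))
            (sym (appendReduce-sound (normalise s) (normalise t)))
    normalise-sound (s ⁻) =
      trans (⁻¹-cong (normalise-sound s)) (sym (invertWord-sound (normalise s)))

  groupLaw : ∀ {k} (xs : Vec Carrier k) (s t : Expr k) →
             normalise s ≡ normalise t → eval (lookup xs) s ≈ eval (lookup xs) t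
  groupLaw xs s t same = begin
    eval (lookup xs) s                   ≈⟨ normalise-sound (lookup xs) s ⟩
    evalWord (lookup xs) (normalise s)   ≡⟨ ≡.cong (evalWord (lookup xs)) same ⟩
    evalWord (lookup xs) (normalise t)   ≈⟨ normalise-sound (lookup xs) t ⟨
    eval (lookup xs) t                   ∎

module VectorSpace where

  ⊕-self : ∀ {m} (v : V m) → v ⊕ v ≡ 𝟎 m
  ⊕-self [] = ≡.refl
  ⊕-self (b ∷ v) = ≡.cong₂ _∷_ (xor-same b) (⊕-self v)

  ⊕-identityˡ : ∀ {m} (v : V m) → 𝟎 m ⊕ v ≡ v
  ⊕-identityˡ = zipWith-identityˡ xor-identityˡ

  tabulate-false : ∀ {m} → tabulate (λ (_ : Fin m) → false) ≡ 𝟎 m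
  tabulate-false {zero} = ≡.refl
  tabulate-false {suc m} = ≡.cong (false ∷_) tabulate-false

  e-zero-⊕ : ∀ {m} (w : V m) → e fzero ⊕ (false ∷ w) ≡ true ∷ w
  e-zero-⊕ w = ≡.cong (true ∷_) (≡.trans (≡.cong (_⊕ w) tabulate-false) (⊕-identityˡ w))

  e-suc : ∀ {m} (i : Fin m) → e (fsuc i) ≡ false ∷ e i
  e-suc i = ≡.cong (false ∷_) (tabulate-cong (λ j → ⌊suc≟suc⌋ j))
    where
    ⌊suc≟suc⌋ : ∀ j → ⌊ fsuc i ≟ᶠ fsuc j ⌋ ≡ ⌊ i ≟ᶠ j ⌋
    ⌊suc≟suc⌋ j with i ≟ᶠ j
    ... | yes _ = ≡.refl
    ... | no _ = ≡.refl

  basis-induction : ∀ {q} m (Q : V m → Set q) → Q (𝟎 m) → (∀ i → Q (e i)) →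
                    (∀ u w → Q u → Q w → Q (u ⊕ w)) → ∀ v → Q v
  basis-induction zero Q q𝟎 qe q⊕ [] = q𝟎
  basis-induction (suc m) Q q𝟎 qe q⊕ (b ∷ w) = head b
    where
    tail : Q (false ∷ w)
    tail = basis-induction m (λ u → Q (false ∷ u)) q𝟎
             (λ i → ≡.subst Q (e-suc i) (qe (fsuc i))) (λ u u' → q⊕ _ _) w
    head : ∀ b → Q (b ∷ w)
    head false = tail
    head true = ≡.subst Q (e-zero-⊕ w) (q⊕ _ _ (qe fzero) tail)

module LowerCentralSeries {c ℓ} (G : Group c ℓ) where
  open Group G
  open GroupDefs G
  open GroupWord
  open GroupWordSemantics G
  open import Relation.Binary.Reasoning.Setoid setoid
  open import Algebra.Properties.Group G using (x≈y⇒x∙y⁻¹≈ε)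

  Derived : Carrier → Set (c ⊔ ℓ)
  Derived = LCS 2

  comm-derived : ∀ x y → Derived ⟦ x , y ⟧
  comm-derived x y = base (x , y , tt , refl)

  conj : Carrier → Carrier → Carrier
  conj x y = x ∙ y ∙ x ⁻¹

  conj≈comm∙ : ∀ x y → conj x y ≈ ⟦ x , y ⟧ ∙ y
  conj≈comm∙ x y = groupLaw (x ∷ y ∷ []) (conjₑ x₀ x₁) ([ x₀ , x₁ ]ₑ · x₁) ≡.refl

  comm-congˡ : ∀ {a b} y → a ≈ b → ⟦ a , y ⟧ ≈ ⟦ b , y ⟧
  comm-congˡ y a≈b = ∙-congʳ (∙-cong (∙-congʳ a≈b) (⁻¹-cong a≈b))

  comm-congʳ : ∀ x {a b} → a ≈ b → ⟦ x , a ⟧ ≈ ⟦ x , b ⟧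
  comm-congʳ x a≈b = ∙-cong (∙-congʳ (∙-congˡ a≈b)) (⁻¹-cong a≈b)

  comm-ε : ∀ x → ⟦ x , ε ⟧ ≈ ε
  comm-ε x = groupLaw (x ∷ []) [ x₀ , one ]ₑ one ≡.refl

  lcs-resp : ∀ m {x y} → x ≈ y → LCS m x → LCS m y
  lcs-resp zero _ _ = tt
  lcs-resp (suc zero) _ _ = tt
  lcs-resp (suc (suc m)) x≈y h = resp x≈y h

  lcs-ε : ∀ m → LCS m ε
  lcs-ε zero = tt
  lcs-ε (suc zero) = tt
  lcs-ε (suc (suc m)) = unit

  lcs-mul : ∀ m {x y} → LCS m x → LCS m y → LCS m (x ∙ y)
  lcs-mul zero _ _ = tt
  lcs-mul (suc zero) _ _ = tt
  lcs-mul (suc (suc m)) hx hy = mul hx hy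

  lcs-inv : ∀ m {x} → LCS m x → LCS m (x ⁻¹)
  lcs-inv zero _ = tt
  lcs-inv (suc zero) _ = tt
  lcs-inv (suc (suc m)) h = inv h

  lcs≈ε : ∀ m {x} → x ≈ ε → LCS m x
  lcs≈ε m x≈ε = lcs-resp m (sym x≈ε) (lcs-ε m)

  gen-mono : ∀ {P Q : Carrier → Set (c ⊔ ℓ)} → (∀ {z} → P z → Q z) → ∀ {x} → Gen P x → Gen Q x
  gen-mono P⊆Q (base p) = base (P⊆Q p)
  gen-mono P⊆Q unit = unit
  gen-mono P⊆Q (mul p q) = mul (gen-mono P⊆Q p) (gen-mono P⊆Q q)
  gen-mono P⊆Q (inv p) = inv (gen-mono P⊆Q p)
  gen-mono P⊆Q (resp x≈y p) = resp x≈y (gen-mono P⊆Q p)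

  lcs-suc⊆ : ∀ m {x} → LCS (suc m) x → LCS m x
  lcs-suc⊆ zero _ = tt
  lcs-suc⊆ (suc zero) _ = tt
  lcs-suc⊆ (suc (suc m)) h =
    gen-mono (λ (x , y , hy , z≈) → x , y , lcs-suc⊆ (suc m) hy , z≈) h

  lcs⊆derived : ∀ m {x} → LCS (suc (suc m)) x → Derived x
  lcs⊆derived zero h = h
  lcs⊆derived (suc m) h = lcs⊆derived m (lcs-suc⊆ (suc (suc m)) h)

  lcs-commˡ : ∀ m x {w} → LCS (suc m) w → LCS (suc (suc m)) ⟦ x , w ⟧
  lcs-commˡ m x {w} h = base (x , w , h , refl)

  lcs-commʳ : ∀ m x {w} → LCS (suc m) w → LCS (suc (suc m)) ⟦ w , x ⟧
  lcs-commʳ m x {w} h =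
    resp (groupLaw (x ∷ w ∷ []) ([ x₀ , x₁ ]ₑ ⁻) [ x₁ , x₀ ]ₑ ≡.refl) (inv (lcs-commˡ m x h))

  lcs-conj : ∀ m x {w} → LCS m w → LCS m (conj x w)
  lcs-conj zero x h = tt
  lcs-conj (suc zero) x h = tt
  lcs-conj (suc (suc m)) x {w} h =
    resp (sym (conj≈comm∙ x w)) (mul (lcs-suc⊆ (suc (suc m)) (lcs-commˡ (suc m) x h)) h)

  LEq-≈ : ∀ m {x y} → LCS m x → x ≈ y → LEq m x y
  LEq-≈ m h x≈y = h , lcs-resp m x≈y h , lcs≈ε (suc m) (x≈y⇒x∙y⁻¹≈ε x≈y)

  LEq-refl : ∀ m {x} → LCS m x → LEq m x x
  LEq-refl m h = LEq-≈ m h refl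

  LEq-ε : ∀ m {x} → x ≈ ε → LEq m x ε
  LEq-ε m x≈ε = LEq-≈ m (lcs≈ε m x≈ε) x≈ε

  LEq-degree1 : ∀ x → LEq 1 x x
  LEq-degree1 x = LEq-refl 1 tt

  LEq-correction : ∀ m {X Y T} → LCS m X → LCS m Y → X ≈ T ∙ Y → LCS (suc m) T → LEq m X Y
  LEq-correction m {X} {Y} {T} hX hY X≈TY hT = hX , hY , lcs-resp (suc m) T≈XY⁻¹ hT
    where
    T≈XY⁻¹ : T ≈ X ∙ Y ⁻¹
    T≈XY⁻¹ = begin
      T               ≈⟨ groupLaw (T ∷ Y ∷ []) x₀ (x₀ · x₁ · x₁ ⁻) ≡.refl ⟩
      T ∙ Y ∙ Y ⁻¹    ≈⟨ ∙-congʳ X≈TY ⟨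
      X ∙ Y ⁻¹        ∎

  LEq-sym : ∀ m {x y} → LEq m x y → LEq m y x
  LEq-sym m {x} {y} (hx , hy , d) =
    hy , hx , lcs-resp (suc m) (groupLaw (x ∷ y ∷ []) ((x₀ · x₁ ⁻) ⁻) (x₁ · x₀ ⁻) ≡.refl)
                                (lcs-inv (suc m) d)

  LEq-trans : ∀ m {x y z} → LEq m x y → LEq m y z → LEq m x z
  LEq-trans m {x} {y} {z} (hx , _ , d) (_ , hz , d') =
    hx , hz , lcs-resp (suc m) (groupLaw (x ∷ y ∷ z ∷ []) ((x₀ · x₁ ⁻) · (x₁ · x₂ ⁻)) (x₀ · x₂ ⁻) ≡.refl)
                                (lcs-mul (suc m) d d')

  -- addition on L_m is well defined: (x y)(x' y')⁻¹ = x (y y'⁻¹) x⁻¹ · x x'⁻¹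
  LEq-∙-cong : ∀ m {x x' y y'} → LEq m x x' → LEq m y y' → LEq m (x ∙ y) (x' ∙ y')
  LEq-∙-cong m {x} {x'} {y} {y'} (hx , hx' , dx) (hy , hy' , dy) =
    lcs-mul m hx hy , lcs-mul m hx' hy' ,
    lcs-resp (suc m)
      (groupLaw (x ∷ x' ∷ y ∷ y' ∷ []) (conjₑ x₀ (x₂ · x₃ ⁻) · (x₀ · x₁ ⁻)) ((x₀ · x₂) · (x₁ · x₃) ⁻) ≡.refl)
      (lcs-mul (suc m) (lcs-conj (suc m) x dy) dx)

  -- addition on L_m is commutative: x y = [x,y] · y x with [x,y] of degree m+1
  LEq-∙-comm : ∀ m {x y} → LCS (suc m) x → LCS (suc m) y → LEq (suc m) (x ∙ y) (y ∙ x)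
  LEq-∙-comm m {x} {y} hx hy =
    LEq-correction (suc m) (lcs-mul (suc m) hx hy) (lcs-mul (suc m) hy hx)
      (groupLaw (x ∷ y ∷ []) (x₀ · x₁) ([ x₀ , x₁ ]ₑ · (x₁ · x₀)) ≡.refl) (lcs-commʳ m y hx)

-- Groups whose derived subgroup K = [G,G] is elementary abelian and contains
-- all squares (so that G/K is elementary abelian as well).
record IsElementaryDerived {c ℓ} (G : Group c ℓ) : Set (c ⊔ ℓ) where
  open Group G
  open LowerCentralSeries G using (Derived)
  field
    derived-comm   : ∀ {x y} → Derived x → Derived y → x ∙ y ≈ y ∙ x
    derived-exp2   : ∀ {x} → Derived x → x ∙ x ≈ ε
    square-derived : ∀ x → Derived (x ∙ x)

module ElementaryDerived {c ℓ} (G : Group c ℓ) (hyp : IsElementaryDerived G) where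
  open Group G
  open GroupDefs G
  open GroupWord
  open GroupWordSemantics G
  open LowerCentralSeries G
  open IsElementaryDerived hyp
  open import Relation.Binary.Reasoning.Setoid setoid
  open import Algebra.Properties.Group G using (inverseʳ-unique)
  module L = LieDefs LEq _∙_ ε ⟦_,_⟧

  derived-inv≈ : ∀ {x} → Derived x → x ⁻¹ ≈ x
  derived-inv≈ {x} h = sym (inverseʳ-unique x x (derived-exp2 h))

  comm-of-derived : ∀ {x y} → Derived x → Derived y → ⟦ x , y ⟧ ≈ ε
  comm-of-derived {x} {y} hx hy = begin
    x ∙ y ∙ x ⁻¹ ∙ y ⁻¹  ≈⟨ ∙-congʳ (∙-congʳ (derived-comm hx hy)) ⟩
    y ∙ x ∙ x ⁻¹ ∙ y ⁻¹  ≈⟨ groupLaw (x ∷ y ∷ []) (x₁ · x₀ · x₀ ⁻ · x₁ ⁻) one ≡.refl ⟩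
    ε                    ∎

  middle-swap : ∀ {a b c d} → b ∙ c ≈ c ∙ b → (a ∙ b) ∙ (c ∙ d) ≈ (a ∙ c) ∙ (b ∙ d)
  middle-swap {a} {b} {c} {d} bc≈cb = begin
    (a ∙ b) ∙ (c ∙ d)  ≈⟨ groupLaw (a ∷ b ∷ c ∷ d ∷ []) ((x₀ · x₁) · (x₂ · x₃)) (x₀ · (x₁ · x₂) · x₃) ≡.refl ⟩
    a ∙ (b ∙ c) ∙ d    ≈⟨ ∙-congʳ (∙-congˡ bc≈cb) ⟩
    a ∙ (c ∙ b) ∙ d    ≈⟨ groupLaw (a ∷ b ∷ c ∷ d ∷ []) (x₀ · (x₂ · x₁) · x₃) ((x₀ · x₂) · (x₁ · x₃)) ≡.refl ⟩
    (a ∙ c) ∙ (b ∙ d)  ∎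

  -- The conjugation action of G on K factors through G/K, which is abelian
  -- of exponent 2.

  conj-trivial : ∀ {k x} → Derived k → Derived x → conj k x ≈ x
  conj-trivial {k} {x} hk hx = begin
    k ∙ x ∙ k ⁻¹  ≈⟨ ∙-congʳ (derived-comm hk hx) ⟩
    x ∙ k ∙ k ⁻¹  ≈⟨ groupLaw (x ∷ k ∷ []) (x₀ · x₁ · x₁ ⁻) x₀ ≡.refl ⟩
    x             ∎

  conj-coset : ∀ {x y c} → Derived (x ∙ y ⁻¹) → Derived c → conj x c ≈ conj y c
  conj-coset {x} {y} {c} hxy hc = begin
    conj x c                    ≈⟨ groupLaw (x ∷ y ∷ c ∷ []) (conjₑ x₀ x₂) (conjₑ (x₀ · x₁ ⁻) (conjₑ x₁ x₂)) ≡.refl ⟩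
    conj (x ∙ y ⁻¹) (conj y c)  ≈⟨ conj-trivial hxy (lcs-conj 2 y hc) ⟩
    conj y c                    ∎

  conj-comm : ∀ x y {c} → Derived c → conj x (conj y c) ≈ conj y (conj x c)
  conj-comm x y {c} hc = begin
    conj x (conj y c)  ≈⟨ groupLaw (x ∷ y ∷ c ∷ []) (conjₑ x₀ (conjₑ x₁ x₂)) (conjₑ (x₀ · x₁) x₂) ≡.refl ⟩
    conj (x ∙ y) c     ≈⟨ conj-coset (lcs-resp 2 xy≈ (comm-derived x y)) hc ⟩
    conj (y ∙ x) c     ≈⟨ groupLaw (x ∷ y ∷ c ∷ []) (conjₑ (x₁ · x₀) x₂) (conjₑ x₁ (conjₑ x₀ x₂)) ≡.refl ⟩
    conj y (conj x c)  ∎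
    where
    xy≈ : ⟦ x , y ⟧ ≈ (x ∙ y) ∙ (y ∙ x) ⁻¹
    xy≈ = groupLaw (x ∷ y ∷ []) [ x₀ , x₁ ]ₑ (x₀ · x₁ · (x₁ · x₀) ⁻) ≡.refl

  conj-square : ∀ x {c} → Derived c → conj x (conj x c) ≈ c
  conj-square x {c} hc = begin
    conj x (conj x c)  ≈⟨ groupLaw (x ∷ c ∷ []) (conjₑ x₀ (conjₑ x₀ x₁)) (conjₑ (x₀ · x₀) x₁) ≡.refl ⟩
    conj (x ∙ x) c     ≈⟨ conj-trivial (square-derived x) hc ⟩
    c                  ∎

  comm≈conj∙ : ∀ x {c} → Derived c → ⟦ x , c ⟧ ≈ conj x c ∙ c
  comm≈conj∙ x hc = ∙-congˡ (derived-inv≈ hc)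

  comm-coset : ∀ {x y c} → Derived (x ∙ y ⁻¹) → Derived c → ⟦ x , c ⟧ ≈ ⟦ y , c ⟧
  comm-coset {x} {y} {c} hxy hc = begin
    ⟦ x , c ⟧     ≈⟨ comm≈conj∙ x hc ⟩
    conj x c ∙ c  ≈⟨ ∙-congʳ (conj-coset hxy hc) ⟩
    conj y c ∙ c  ≈⟨ comm≈conj∙ y hc ⟨
    ⟦ y , c ⟧     ∎

  comm-comm-expand : ∀ x y {c} → Derived c →
                     ⟦ x , ⟦ y , c ⟧ ⟧ ≈ (conj x (conj y c) ∙ conj x c) ∙ (conj y c ∙ c)
  comm-comm-expand x y {c} hc = begin
    ⟦ x , ⟦ y , c ⟧ ⟧                              ≈⟨ comm≈conj∙ x (comm-derived y c) ⟩
    conj x ⟦ y , c ⟧ ∙ ⟦ y , c ⟧                   ≈⟨ ∙-cong (∙-congʳ (∙-congˡ (comm≈conj∙ y hc))) (comm≈conj∙ y hc) ⟩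
    conj x (conj y c ∙ c) ∙ (conj y c ∙ c)         ≈⟨ ∙-congʳ (groupLaw (x ∷ conj y c ∷ c ∷ []) (conjₑ x₀ (x₁ · x₂)) (conjₑ x₀ x₁ · conjₑ x₀ x₂) ≡.refl) ⟩
    (conj x (conj y c) ∙ conj x c) ∙ (conj y c ∙ c) ∎

  comm-comm-swap : ∀ x y {c} → Derived c → ⟦ x , ⟦ y , c ⟧ ⟧ ≈ ⟦ y , ⟦ x , c ⟧ ⟧
  comm-comm-swap x y {c} hc = begin
    ⟦ x , ⟦ y , c ⟧ ⟧                               ≈⟨ comm-comm-expand x y hc ⟩
    (conj x (conj y c) ∙ conj x c) ∙ (conj y c ∙ c) ≈⟨ middle-swap (derived-comm (lcs-conj 2 x hc) (lcs-conj 2 y hc)) ⟩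
    (conj x (conj y c) ∙ conj y c) ∙ (conj x c ∙ c) ≈⟨ ∙-congʳ (∙-congʳ (conj-comm x y hc)) ⟩
    (conj y (conj x c) ∙ conj y c) ∙ (conj x c ∙ c) ≈⟨ comm-comm-expand y x hc ⟨
    ⟦ y , ⟦ x , c ⟧ ⟧                               ∎

  comm-comm-self : ∀ x {c} → Derived c → ⟦ x , ⟦ x , c ⟧ ⟧ ≈ ε
  comm-comm-self x {c} hc = begin
    ⟦ x , ⟦ x , c ⟧ ⟧                               ≈⟨ comm-comm-expand x x hc ⟩
    (conj x (conj x c) ∙ conj x c) ∙ (conj x c ∙ c) ≈⟨ ∙-congʳ (∙-congʳ (conj-square x hc)) ⟩
    (c ∙ conj x c) ∙ (conj x c ∙ c)                 ≈⟨ groupLaw (c ∷ conj x c ∷ []) ((x₀ · x₁) · (x₁ · x₀)) (x₀ · (x₁ · x₁) · x₀) ≡.refl ⟩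
    c ∙ (conj x c ∙ conj x c) ∙ c                   ≈⟨ ∙-congʳ (∙-congˡ (derived-exp2 (lcs-conj 2 x hc))) ⟩
    c ∙ ε ∙ c                                       ≈⟨ groupLaw (c ∷ []) (x₀ · one · x₀) (x₀ · x₀) ≡.refl ⟩
    c ∙ c                                           ≈⟨ derived-exp2 hc ⟩
    ε                                               ∎

  -- [x,y] = [y,x]⁻¹ = [y,x]
  comm-symmetric : ∀ x y → ⟦ x , y ⟧ ≈ ⟦ y , x ⟧
  comm-symmetric x y =
    trans (groupLaw (x ∷ y ∷ []) [ x₀ , x₁ ]ₑ ([ x₁ , x₀ ]ₑ ⁻) ≡.refl) (derived-inv≈ (comm-derived y x))

  comm-mulˡ : ∀ a b y → ⟦ a ∙ b , y ⟧ ≈ ⟦ a , ⟦ b , y ⟧ ⟧ ∙ (⟦ a , y ⟧ ∙ ⟦ b , y ⟧)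
  comm-mulˡ a b y = begin
    ⟦ a ∙ b , y ⟧                               ≈⟨ groupLaw (a ∷ b ∷ y ∷ []) [ x₀ · x₁ , x₂ ]ₑ (([ x₀ , [ x₁ , x₂ ]ₑ ]ₑ · [ x₁ , x₂ ]ₑ) · [ x₀ , x₂ ]ₑ) ≡.refl ⟩
    (⟦ a , ⟦ b , y ⟧ ⟧ ∙ ⟦ b , y ⟧) ∙ ⟦ a , y ⟧  ≈⟨ assoc _ _ _ ⟩
    ⟦ a , ⟦ b , y ⟧ ⟧ ∙ (⟦ b , y ⟧ ∙ ⟦ a , y ⟧)  ≈⟨ ∙-congˡ (derived-comm (comm-derived b y) (comm-derived a y)) ⟩
    ⟦ a , ⟦ b , y ⟧ ⟧ ∙ (⟦ a , y ⟧ ∙ ⟦ b , y ⟧)  ∎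

  comm-mulʳ : ∀ x a b → ⟦ x , a ∙ b ⟧ ≈ ⟦ a , ⟦ x , b ⟧ ⟧ ∙ (⟦ x , a ⟧ ∙ ⟦ x , b ⟧)
  comm-mulʳ x a b = begin
    ⟦ x , a ∙ b ⟧                               ≈⟨ groupLaw (x ∷ a ∷ b ∷ []) [ x₀ , x₁ · x₂ ]ₑ ([ x₀ , x₁ ]ₑ · ([ x₁ , [ x₀ , x₂ ]ₑ ]ₑ · [ x₀ , x₂ ]ₑ)) ≡.refl ⟩
    ⟦ x , a ⟧ ∙ (⟦ a , ⟦ x , b ⟧ ⟧ ∙ ⟦ x , b ⟧)  ≈⟨ assoc _ _ _ ⟨
    (⟦ x , a ⟧ ∙ ⟦ a , ⟦ x , b ⟧ ⟧) ∙ ⟦ x , b ⟧  ≈⟨ ∙-congʳ (derived-comm (comm-derived x a) (comm-derived a _)) ⟩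
    (⟦ a , ⟦ x , b ⟧ ⟧ ∙ ⟦ x , a ⟧) ∙ ⟦ x , b ⟧  ≈⟨ assoc _ _ _ ⟩
    ⟦ a , ⟦ x , b ⟧ ⟧ ∙ (⟦ x , a ⟧ ∙ ⟦ x , b ⟧)  ∎

  -- [x,[y,z]] = [y,[x,z]] [z,[x,y]], obtained by expanding
  -- [x,[y,z]] = [a y, b z] [y,z]⁻¹ with a = [x,y], b = [x,z] ∈ K
  comm-comm-split : ∀ x y z → ⟦ x , ⟦ y , z ⟧ ⟧ ≈ ⟦ y , ⟦ x , z ⟧ ⟧ ∙ ⟦ z , ⟦ x , y ⟧ ⟧
  comm-comm-split x y z = begin
    ⟦ x , ⟦ y , z ⟧ ⟧          ≈⟨ groupLaw (x ∷ y ∷ z ∷ []) [ x₀ , [ x₁ , x₂ ]ₑ ]ₑ ([ [ x₀ , x₁ ]ₑ · x₁ , [ x₀ , x₂ ]ₑ · x₂ ]ₑ · [ x₁ , x₂ ]ₑ ⁻) ≡.refl ⟩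
    ⟦ a ∙ y , b ∙ z ⟧ ∙ C ⁻¹   ≈⟨ ∙-congʳ expand ⟩
    ((B ∙ C) ∙ A) ∙ C ⁻¹       ≈⟨ ∙-congʳ reorder ⟩
    ((B ∙ A) ∙ C) ∙ C ⁻¹       ≈⟨ groupLaw (B ∷ A ∷ C ∷ []) (x₀ · x₁ · x₂ · x₂ ⁻) (x₀ · x₁) ≡.refl ⟩
    B ∙ A                      ∎
    where
    a = ⟦ x , y ⟧
    b = ⟦ x , z ⟧
    A = ⟦ z , a ⟧
    B = ⟦ y , b ⟧
    C = ⟦ y , z ⟧
    -- conjugation by a, b ∈ K fixes the commutators in K
    yBC : ⟦ y , b ∙ z ⟧ ≈ B ∙ C
    yBC = begin
      ⟦ y , b ∙ z ⟧        ≈⟨ groupLaw (y ∷ b ∷ z ∷ []) [ x₀ , x₁ · x₂ ]ₑ ([ x₀ , x₁ ]ₑ · conjₑ x₁ [ x₀ , x₂ ]ₑ) ≡.refl ⟩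
      B ∙ conj b C         ≈⟨ ∙-congˡ (conj-trivial (comm-derived x z) (comm-derived y z)) ⟩
      B ∙ C                ∎
    aA : ⟦ a , b ∙ z ⟧ ≈ A
    aA = begin
      ⟦ a , b ∙ z ⟧             ≈⟨ comm-symmetric a (b ∙ z) ⟩
      ⟦ b ∙ z , a ⟧             ≈⟨ groupLaw (b ∷ z ∷ a ∷ []) [ x₀ · x₁ , x₂ ]ₑ (conjₑ x₀ [ x₁ , x₂ ]ₑ · [ x₀ , x₂ ]ₑ) ≡.refl ⟩
      conj b A ∙ ⟦ b , a ⟧      ≈⟨ ∙-cong (conj-trivial (comm-derived x z) (comm-derived z a)) (comm-of-derived (comm-derived x z) (comm-derived x y)) ⟩
      A ∙ ε                     ≈⟨ identityʳ _ ⟩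
      A                         ∎
    expand : ⟦ a ∙ y , b ∙ z ⟧ ≈ (B ∙ C) ∙ A
    expand = begin
      ⟦ a ∙ y , b ∙ z ⟧                        ≈⟨ groupLaw (a ∷ y ∷ b ∙ z ∷ []) [ x₀ · x₁ , x₂ ]ₑ (conjₑ x₀ [ x₁ , x₂ ]ₑ · [ x₀ , x₂ ]ₑ) ≡.refl ⟩
      conj a ⟦ y , b ∙ z ⟧ ∙ ⟦ a , b ∙ z ⟧      ≈⟨ ∙-cong (conj-trivial (comm-derived x y) (comm-derived y _)) aA ⟩
      ⟦ y , b ∙ z ⟧ ∙ A                        ≈⟨ ∙-congʳ yBC ⟩
      (B ∙ C) ∙ A                              ∎
    reorder : (B ∙ C) ∙ A ≈ (B ∙ A) ∙ C
    reorder = begin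
      (B ∙ C) ∙ A  ≈⟨ assoc _ _ _ ⟩
      B ∙ (C ∙ A)  ≈⟨ ∙-congˡ (derived-comm (comm-derived y z) (comm-derived z a)) ⟩
      B ∙ (A ∙ C)  ≈⟨ assoc _ _ _ ⟨
      (B ∙ A) ∙ C  ∎

  jacobi-exact : ∀ x y z → (⟦ x , ⟦ y , z ⟧ ⟧ ∙ ⟦ y , ⟦ z , x ⟧ ⟧) ∙ ⟦ z , ⟦ x , y ⟧ ⟧ ≈ ε
  jacobi-exact x y z = begin
    (⟦ x , ⟦ y , z ⟧ ⟧ ∙ ⟦ y , ⟦ z , x ⟧ ⟧) ∙ A ≈⟨ ∙-congʳ (∙-cong (comm-comm-split x y z) (comm-congʳ y (comm-symmetric z x))) ⟩
    ((B ∙ A) ∙ B) ∙ A                           ≈⟨ ∙-congʳ (assoc _ _ _) ⟩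
    (B ∙ (A ∙ B)) ∙ A                           ≈⟨ ∙-congʳ (∙-congˡ (derived-comm (comm-derived z _) (comm-derived y _))) ⟩
    (B ∙ (B ∙ A)) ∙ A                           ≈⟨ groupLaw (B ∷ A ∷ []) ((x₀ · (x₀ · x₁)) · x₁) ((x₀ · x₀) · (x₁ · x₁)) ≡.refl ⟩
    (B ∙ B) ∙ (A ∙ A)                           ≈⟨ ∙-cong (derived-exp2 (comm-derived y _)) (derived-exp2 (comm-derived z _)) ⟩
    ε ∙ ε                                       ≈⟨ identityˡ _ ⟩
    ε                                           ∎
    where
    A = ⟦ z , ⟦ x , y ⟧ ⟧
    B = ⟦ y , ⟦ x , z ⟧ ⟧

  lcs-comm : ∀ h k {x y} → LCS (suc h) x → LCS (suc k) y → LCS (suc h + suc k) ⟦ x , y ⟧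
  lcs-comm zero k {x} hx hy = lcs-commˡ k x hy
  lcs-comm (suc h) zero {x} {y} hx hy =
    ≡.subst (λ m → LCS m ⟦ x , y ⟧) (≡.cong (λ m → suc (suc m)) (+-comm 1 h)) (lcs-commʳ (suc h) y hx)
  lcs-comm (suc h) (suc k) hx hy =
    lcs≈ε (suc (suc h) + suc (suc k)) (comm-of-derived (lcs⊆derived h hx) (lcs⊆derived k hy))

  -- every element of L_m has order 2, using x² ∈ K and, in degree ≥ 2, exp(K) = 2
  LEq-∙-self : ∀ m {x} → LCS (suc m) x → LEq (suc m) (x ∙ x) ε
  LEq-∙-self zero {x} _ =
    tt , tt , resp (groupLaw (x ∷ []) (x₀ · x₀) (x₀ · x₀ · one ⁻) ≡.refl) (square-derived x)
  LEq-∙-self (suc m) hx = LEq-ε (suc (suc m)) (derived-exp2 (lcs⊆derived m hx))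

  -- [x,y] ~ [x',y] when x ~ x': write x = d x' with d of degree h+2
  bracket-congˡ : ∀ h k {x x' y} → LEq (suc h) x x' → LCS (suc k) y →
                  LEq (suc h + suc k) ⟦ x , y ⟧ ⟦ x' , y ⟧
  bracket-congˡ h k {x} {x'} {y} (hx , hx' , hd) hy =
    LEq-correction (suc h + suc k) (lcs-comm h k hx hy) (lcs-comm h k hx' hy) split
      (lcs-mul (suc (suc h + suc k)) (lcs-commˡ (h + suc k) d (lcs-comm h k hx' hy)) (lcs-comm (suc h) k hd hy))
    where
    d = x ∙ x' ⁻¹
    split : ⟦ x , y ⟧ ≈ (⟦ d , ⟦ x' , y ⟧ ⟧ ∙ ⟦ d , y ⟧) ∙ ⟦ x' , y ⟧
    split = begin
      ⟦ x , y ⟧                                  ≈⟨ comm-congˡ y (groupLaw (x ∷ x' ∷ []) x₀ ((x₀ · x₁ ⁻) · x₁) ≡.refl) ⟩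
      ⟦ d ∙ x' , y ⟧                             ≈⟨ comm-mulˡ d x' y ⟩
      ⟦ d , ⟦ x' , y ⟧ ⟧ ∙ (⟦ d , y ⟧ ∙ ⟦ x' , y ⟧) ≈⟨ assoc _ _ _ ⟨
      (⟦ d , ⟦ x' , y ⟧ ⟧ ∙ ⟦ d , y ⟧) ∙ ⟦ x' , y ⟧ ∎

  -- [x,y] ~ [x,y'] when y ~ y': write y = d y' with d of degree k+2
  bracket-congʳ : ∀ h k {x y y'} → LCS (suc h) x → LEq (suc k) y y' →
                  LEq (suc h + suc k) ⟦ x , y ⟧ ⟦ x , y' ⟧
  bracket-congʳ h k {x} {y} {y'} hx (hy , hy' , hd) =
    LEq-correction (suc h + suc k) (lcs-comm h k hx hy) (lcs-comm h k hx hy') split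
      (lcs-mul (suc (suc h + suc k)) (lcs-commˡ (h + suc k) d (lcs-comm h k hx hy'))
        (≡.subst (λ m → LCS m ⟦ x , d ⟧) (+-suc (suc h) (suc k)) (lcs-comm h (suc k) hx hd)))
    where
    d = y ∙ y' ⁻¹
    split : ⟦ x , y ⟧ ≈ (⟦ d , ⟦ x , y' ⟧ ⟧ ∙ ⟦ x , d ⟧) ∙ ⟦ x , y' ⟧
    split = begin
      ⟦ x , y ⟧                                  ≈⟨ comm-congʳ x (groupLaw (y ∷ y' ∷ []) x₀ ((x₀ · x₁ ⁻) · x₁) ≡.refl) ⟩
      ⟦ x , d ∙ y' ⟧                             ≈⟨ comm-mulʳ x d y' ⟩
      ⟦ d , ⟦ x , y' ⟧ ⟧ ∙ (⟦ x , d ⟧ ∙ ⟦ x , y' ⟧) ≈⟨ assoc _ _ _ ⟨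
      (⟦ d , ⟦ x , y' ⟧ ⟧ ∙ ⟦ x , d ⟧) ∙ ⟦ x , y' ⟧ ∎

  bracket-cong : ∀ h k {x x' y y'} → LEq (suc h) x x' → LEq (suc k) y y' →
                 LEq (suc h + suc k) ⟦ x , y ⟧ ⟦ x' , y' ⟧
  bracket-cong h k x~x' y~y' =
    LEq-trans (suc h + suc k) (bracket-congˡ h k x~x' (proj₁ y~y')) (bracket-congʳ h k (proj₁ (proj₂ x~x')) y~y')

  -- bilinearity: the cross term [a,[b,y]] resp. [a,[x,b]] has degree h+k+3
  bracket-distribʳ : ∀ h k {x x' y} → LCS (suc h) x → LCS (suc h) x' → LCS (suc k) y →
                     LEq (suc h + suc k) ⟦ x ∙ x' , y ⟧ (⟦ x , y ⟧ ∙ ⟦ x' , y ⟧)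
  bracket-distribʳ h k {x} {x'} {y} hx hx' hy =
    LEq-correction (suc h + suc k) (lcs-comm h k (lcs-mul (suc h) hx hx') hy)
      (lcs-mul (suc h + suc k) (lcs-comm h k hx hy) (lcs-comm h k hx' hy))
      (comm-mulˡ x x' y) (lcs-commˡ (h + suc k) x (lcs-comm h k hx' hy))

  bracket-distribˡ : ∀ h k {x y y'} → LCS (suc h) x → LCS (suc k) y → LCS (suc k) y' →
                     LEq (suc h + suc k) ⟦ x , y ∙ y' ⟧ (⟦ x , y ⟧ ∙ ⟦ x , y' ⟧)
  bracket-distribˡ h k {x} {y} {y'} hx hy hy' =
    LEq-correction (suc h + suc k) (lcs-comm h k hx (lcs-mul (suc k) hy hy'))
      (lcs-mul (suc h + suc k) (lcs-comm h k hx hy) (lcs-comm h k hx hy'))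
      (comm-mulʳ x y y') (lcs-commˡ (h + suc k) y (lcs-comm h k hx hy'))

  gradedLieAlgebra : L.IsGradedLieAlgebra₂
  gradedLieAlgebra = record
    { ≈-sym       = λ {m} → LEq-sym (suc m)
    ; ≈-trans     = λ {m} → LEq-trans (suc m)
    ; 0-valid     = λ m → LEq-refl (suc m) (lcs-ε (suc m))
    ; +-cong      = λ {m} → LEq-∙-cong (suc m)
    ; +-assoc     = λ {m} (hx , _) (hy , _) (hz , _) →
        LEq-≈ (suc m) (lcs-mul (suc m) (lcs-mul (suc m) hx hy) hz) (assoc _ _ _)
    ; +-comm      = λ {m} (hx , _) (hy , _) → LEq-∙-comm m hx hy
    ; +-identityʳ = λ {m} (hx , _) → LEq-≈ (suc m) (lcs-mul (suc m) hx (lcs-ε (suc m))) (identityʳ _)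
    ; +-self      = λ {m} (hx , _) → LEq-∙-self m hx
    ; br-cong     = λ {h} {k} → bracket-cong h k
    ; br-distribʳ = λ {h} {k} (hx , _) (hx' , _) (hy , _) → bracket-distribʳ h k hx hx' hy
    ; br-distribˡ = λ {h} {k} (hx , _) (hy , _) (hy' , _) → bracket-distribˡ h k hx hy hy'
    ; br-self     = λ {h} {x} _ → LEq-ε (suc h + suc h) (groupLaw (x ∷ []) [ x₀ , x₀ ]ₑ one ≡.refl)
    ; br-anticomm = λ {h} {k} {x} {y} (hx , _) (hy , _) →
        LEq-≈ (suc h + suc k) (lcs-comm h k hx hy) (comm-symmetric x y)
    ; jacobi      = λ {h} {k} {l} {x} {y} {z} _ _ _ → LEq-ε (suc h + suc k + suc l) (jacobi-exact x y z)
    }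

  no-bracket-in-degree1 : ∀ h k → suc h + suc k ≢ 1
  no-bracket-in-degree1 zero k ()
  no-bracket-in-degree1 (suc h) k ()

  span⊆derived : ∀ {x} → L.Span 1 x → Derived x
  span⊆derived (L.bracket {h} {k} eq _ _) = ⊥-elim (no-bracket-in-degree1 h k eq)
  span⊆derived L.zero = unit
  span⊆derived (L.plus s t) = mul (span⊆derived s) (span⊆derived t)
  span⊆derived (L.resp {x = x} {y = y} s (_ , _ , hd)) =
    resp (groupLaw (x ∷ y ∷ []) ((x₀ · x₁ ⁻) ⁻ · x₀) x₁ ≡.refl) (mul (inv hd) (span⊆derived s))

  derived⊆span : ∀ {x} → Derived x → L.Span 1 x
  derived⊆span {x} hx = L.resp L.zero (tt , tt , resp (groupLaw (x ∷ []) (x₀ ⁻) (one · x₀ ⁻) ≡.refl) (inv hx))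

  span⊆lcs : ∀ {m x} → L.Span (suc (suc m)) x → LCS (suc (suc m)) x
  span⊆lcs {x = x} (L.bracket {h} {k} eq hx hy) =
    ≡.subst (λ m → LCS m x) eq (lcs-comm h k (proj₁ hx) (proj₁ hy))
  span⊆lcs {m} L.zero = lcs-ε (suc (suc m))
  span⊆lcs {m} (L.plus s t) = lcs-mul (suc (suc m)) (span⊆lcs s) (span⊆lcs t)
  span⊆lcs (L.resp s x~y) = proj₁ (proj₂ x~y)

  lcs⊆span : ∀ {m x} → LCS (suc (suc m)) x → L.Span (suc (suc m)) x
  lcs⊆span {m} (base (a , b , hb , x≈)) =
    L.resp (L.bracket {0} {m} ≡.refl (LEq-degree1 a) (LEq-refl (suc m) hb))
           (LEq-≈ (suc (suc m)) (lcs-commˡ m a hb) (sym x≈))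
  lcs⊆span unit = L.zero
  lcs⊆span (mul p q) = L.plus (lcs⊆span p) (lcs⊆span q)
  lcs⊆span {m} (inv p) = L.resp (lcs⊆span p) (LEq-≈ (suc (suc m)) p (sym (derived-inv≈ (lcs⊆derived m p))))
  lcs⊆span {m} (resp x≈y p) = L.resp (lcs⊆span p) (LEq-≈ (suc (suc m)) p x≈y)

  nest-lcs : ∀ k (σ : Fin k → Carrier) a b → LCS (suc (suc k)) (L.nest σ a b)
  nest-lcs zero σ a b = comm-derived a b
  nest-lcs (suc k) σ a b = lcs-commˡ (suc k) (σ fzero) (nest-lcs k (λ i → σ (fsuc i)) a b)

  nest-derived : ∀ k (σ : Fin k → Carrier) a b → Derived (L.nest σ a b)
  nest-derived k σ a b = lcs⊆derived k (nest-lcs k σ a b)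

  -- bracketing with x kills a nest containing an entry congruent to x mod K:
  -- move x next to that entry (comm-comm-swap) and use [x,[x,c]] = 1
  nest-absorb : ∀ k (τ : Fin k → Carrier) a b (t : Fin k) x → Derived (τ t ∙ x ⁻¹) →
                ⟦ x , L.nest τ a b ⟧ ≈ ε
  nest-absorb (suc k) τ a b fzero x hτx = begin
    ⟦ x , ⟦ τ fzero , r ⟧ ⟧  ≈⟨ comm-congʳ x (comm-coset hτx (nest-derived k _ a b)) ⟩
    ⟦ x , ⟦ x , r ⟧ ⟧        ≈⟨ comm-comm-self x (nest-derived k _ a b) ⟩
    ε                        ∎
    where r = L.nest (λ i → τ (fsuc i)) a b
  nest-absorb (suc k) τ a b (fsuc t) x hτx = begin
    ⟦ x , ⟦ τ fzero , r ⟧ ⟧  ≈⟨ comm-comm-swap x (τ fzero) (nest-derived k _ a b) ⟩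
    ⟦ τ fzero , ⟦ x , r ⟧ ⟧  ≈⟨ comm-congʳ (τ fzero) (nest-absorb k (λ i → τ (fsuc i)) a b t x hτx) ⟩
    ⟦ τ fzero , ε ⟧          ≈⟨ comm-ε _ ⟩
    ε                        ∎
    where r = L.nest (λ i → τ (fsuc i)) a b

  nest-repeat : ∀ k (σ : Fin k → Carrier) a b (s t : Fin k) → s ≢ t →
                Derived (σ s ∙ σ t ⁻¹) → L.nest σ a b ≈ ε
  nest-repeat (suc k) σ a b fzero fzero s≢t _ = ⊥-elim (s≢t ≡.refl)
  nest-repeat (suc k) σ a b fzero (fsuc t) _ hst =
    nest-absorb k (λ i → σ (fsuc i)) a b t (σ fzero)
      (resp (groupLaw (σ fzero ∷ σ (fsuc t) ∷ []) ((x₀ · x₁ ⁻) ⁻) (x₁ · x₀ ⁻) ≡.refl) (inv hst))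
  nest-repeat (suc k) σ a b (fsuc s) fzero _ hst = nest-absorb k (λ i → σ (fsuc i)) a b s (σ fzero) hst
  nest-repeat (suc k) σ a b (fsuc s) (fsuc t) s≢t hst =
    trans (comm-congʳ (σ fzero) (nest-repeat k (λ i → σ (fsuc i)) a b s t (λ s≡t → s≢t (≡.cong fsuc s≡t)) hst))
          (comm-ε _)

  -- A list of elements acts on K by iterated commutators.  Since these
  -- operators commute, lists modulo "same action on K" form a commutative
  -- monoid, and a nest is the action of the sum of its entries.

  act : List Carrier → Carrier → Carrier
  act [] c = c
  act (x ∷ l) c = ⟦ x , act l c ⟧

  act-derived : ∀ l {c} → Derived c → Derived (act l c)
  act-derived [] hc = hc
  act-derived (x ∷ l) hc = comm-derived _ _

  act-cong : ∀ l {c d} → c ≈ d → act l c ≈ act l d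
  act-cong [] c≈d = c≈d
  act-cong (x ∷ l) c≈d = comm-congʳ x (act-cong l c≈d)

  act-++ : ∀ l l' c → act (l ++ l') c ≡ act l (act l' c)
  act-++ [] l' c = ≡.refl
  act-++ (x ∷ l) l' c = ≡.cong (λ z → ⟦ x , z ⟧) (act-++ l l' c)

  act-swap₁ : ∀ x l {c} → Derived c → ⟦ x , act l c ⟧ ≈ act l ⟦ x , c ⟧
  act-swap₁ x [] hc = refl
  act-swap₁ x (y ∷ l) hc = trans (comm-comm-swap x y (act-derived l hc)) (comm-congʳ y (act-swap₁ x l hc))

  act-swap : ∀ l l' {c} → Derived c → act l (act l' c) ≈ act l' (act l c)
  act-swap [] l' hc = refl
  act-swap (x ∷ l) l' hc = trans (comm-congʳ x (act-swap l l' hc)) (act-swap₁ x l' (act-derived l hc))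

  _≋_ : List Carrier → List Carrier → Set (c ⊔ ℓ)
  l ≋ l' = ∀ c → Derived c → act l c ≈ act l' c

  operatorMonoid : CommutativeMonoid c (c ⊔ ℓ)
  operatorMonoid = record
    { Carrier = List Carrier
    ; _≈_ = _≋_
    ; _∙_ = _++_
    ; ε = []
    ; isCommutativeMonoid = record
      { isMonoid = record
        { isSemigroup = record
          { isMagma = record
            { isEquivalence = record
              { refl = λ c hc → refl
              ; sym = λ l≋l' c hc → sym (l≋l' c hc)
              ; trans = λ l≋l' l'≋l'' c hc → trans (l≋l' c hc) (l'≋l'' c hc) }
            ; ∙-cong = λ {l₁} {l₁'} {l₂} {l₂'} l₁≋ l₂≋ c hc →
                trans (reflexive (act-++ l₁ l₂ c))
                (trans (act-cong l₁ (l₂≋ c hc))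
                (trans (l₁≋ _ (act-derived l₂' hc)) (reflexive (≡.sym (act-++ l₁' l₂' c))))) }
          ; assoc = λ l₁ l₂ l₃ c hc → reflexive (≡.cong (λ l → act l c) (++-assoc l₁ l₂ l₃)) }
        ; identity = (λ l c hc → refl) , (λ l c hc → reflexive (≡.cong (λ l' → act l' c) (++-identityʳ l))) }
      ; comm = λ l l' c hc → trans (reflexive (act-++ l l' c))
                (trans (act-swap l l' hc) (reflexive (≡.sym (act-++ l' l c)))) } }

  module OperatorSum = CommutativeMonoidSum operatorMonoid

  nest≡act : ∀ k (σ : Fin k → Carrier) a b → L.nest σ a b ≡ act (OperatorSum.sum (λ s → σ s ∷ [])) ⟦ a , b ⟧
  nest≡act zero σ a b = ≡.refl
  nest≡act (suc k) σ a b = ≡.cong (λ z → ⟦ σ fzero , z ⟧) (nest≡act k (λ i → σ (fsuc i)) a b)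

  nest-permute : ∀ k (σ : Fin k → Carrier) a b (π : Permutation k k) →
                 L.nest (λ s → σ (π ⟨$⟩ʳ s)) a b ≈ L.nest σ a b
  nest-permute k σ a b π = begin
    L.nest (λ s → σ (π ⟨$⟩ʳ s)) a b                     ≡⟨ nest≡act k (λ s → σ (π ⟨$⟩ʳ s)) a b ⟩
    act (OperatorSum.sum (λ s → σ (π ⟨$⟩ʳ s) ∷ [])) ⟦ a , b ⟧
      ≈⟨ OperatorSum.sum-permute (λ s → σ s ∷ []) π ⟦ a , b ⟧ (comm-derived a b) ⟨
    act (OperatorSum.sum (λ s → σ s ∷ [])) ⟦ a , b ⟧     ≡⟨ nest≡act k σ a b ⟨
    L.nest σ a b                                         ∎

  -- Engel condition: if τ² has degree 3 then [τ,[τ,y]] has degree 4, since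
  -- [τ,[τ,y]] = τ [y,τ⁻²] τ⁻¹ holds exactly in G
  engel-of-square : ∀ τ y → LCS 3 (τ ∙ τ) → LEq 3 ⟦ τ , ⟦ τ , y ⟧ ⟧ ε
  engel-of-square τ y hτ² =
    LEq-correction 3 (lcs-commˡ 1 τ (lcs-commˡ 0 τ {y} tt)) (lcs-ε 3) (trans expand (sym (identityʳ _)))
      (lcs-conj 4 τ (lcs-commˡ 2 y (lcs-inv 3 hτ²)))
    where
    T = conj τ ⟦ y , (τ ∙ τ) ⁻¹ ⟧
    C = ⟦ y , τ ⟧
    expand : ⟦ τ , ⟦ τ , y ⟧ ⟧ ≈ T
    expand = begin
      ⟦ τ , ⟦ τ , y ⟧ ⟧                          ≈⟨ groupLaw (τ ∷ y ∷ []) [ x₀ , [ x₀ , x₁ ]ₑ ]ₑ (conjₑ (x₀ · x₀) [ x₁ , x₀ ⁻ ]ₑ · [ x₀ , x₁ ]ₑ ⁻) ≡.refl ⟩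
      conj (τ ∙ τ) ⟦ y , τ ⁻¹ ⟧ ∙ ⟦ τ , y ⟧ ⁻¹    ≈⟨ ∙-congʳ (conj-trivial (square-derived τ) (comm-derived y (τ ⁻¹))) ⟩
      ⟦ y , τ ⁻¹ ⟧ ∙ ⟦ τ , y ⟧ ⁻¹                 ≈⟨ groupLaw (τ ∷ y ∷ []) ([ x₁ , x₀ ⁻ ]ₑ · [ x₀ , x₁ ]ₑ ⁻) (([ x₁ , x₀ ]ₑ · conjₑ x₀ [ x₁ , (x₀ · x₀) ⁻ ]ₑ) · [ x₁ , x₀ ]ₑ) ≡.refl ⟩
      (C ∙ T) ∙ C                                ≈⟨ ∙-congʳ (derived-comm (comm-derived y τ) (lcs-conj 2 τ (comm-derived _ _))) ⟩
      (T ∙ C) ∙ C                                ≈⟨ assoc _ _ _ ⟩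
      T ∙ (C ∙ C)                                ≈⟨ ∙-congˡ (derived-exp2 (comm-derived y τ)) ⟩
      T ∙ ε                                      ≈⟨ identityʳ _ ⟩
      T                                          ∎

-- n-expansion groups: K = ker φ is the derived subgroup, hence elementary
-- abelian, and contains all squares because V_[n] has exponent 2.
module ExpansionGroup {c ℓ} (n : ℕ) (G : Group c ℓ)
  (φ : Group.Carrier G → V n) (g : Fin n → Group.Carrier G)
  (ex : GroupDefs.IsNExpansionGroup G n φ g) where
  open Group G
  open GroupDefs G
  open GroupWord
  open GroupWordSemantics G
  open LowerCentralSeries G
  open IsNExpansionGroup ex
  open VectorSpace
  open import Algebra.Properties.Group G using (inverseʳ-unique)

  square-in-kernel : ∀ x → φ (x ∙ x) ≡ 𝟎 n
  square-in-kernel x = ≡.trans (φ-hom x x) (⊕-self (φ x))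

  elementaryDerived : IsElementaryDerived G
  elementaryDerived = record
    { derived-comm   = λ hx hy → ker-comm _ _ (derived⊆ker _ hx) (derived⊆ker _ hy)
    ; derived-exp2   = λ hx → ker-exp2 _ (derived⊆ker _ hx)
    ; square-derived = λ x → ker⊆derived _ (square-in-kernel x)
    }

  open IsElementaryDerived elementaryDerived using (derived-comm)
  open ElementaryDerived G elementaryDerived

  -- L₁(φ) is well defined: x ~₁ y means x y⁻¹ ∈ ker φ
  φ-cong₁ : ∀ {x y} → LEq 1 x y → φ x ≡ φ y
  φ-cong₁ {x} {y} (_ , _ , hd) = begin
    φ x                    ≡⟨ φ-cong (groupLaw (x ∷ y ∷ []) x₀ ((x₀ · x₁ ⁻) · x₁) ≡.refl) ⟩
    φ (x ∙ y ⁻¹ ∙ y)       ≡⟨ φ-hom _ _ ⟩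
    φ (x ∙ y ⁻¹) ⊕ φ y     ≡⟨ ≡.cong (_⊕ φ y) (derived⊆ker _ hd) ⟩
    𝟎 n ⊕ φ y              ≡⟨ ⊕-identityˡ (φ y) ⟩
    φ y                    ∎
    where open ≡.≡-Reasoning

  -- L₁(φ) is onto, since its image contains the basis
  φ-surj : ∀ (v : V n) → ∃[ x ] (LEq 1 x x × φ x ≡ v)
  φ-surj = basis-induction n _
    (ε , LEq-degree1 ε , derived⊆ker _ unit)
    (λ i → g i , LEq-degree1 (g i) , φ-gen i)
    (λ u w (x , _ , φx≡u) (y , _ , φy≡w) →
      x ∙ y , LEq-degree1 _ , ≡.trans (φ-hom x y) (≡.cong₂ _⊕_ φx≡u φy≡w))

  Ker : ℕ → Carrier → Set (c ⊔ ℓ)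
  Ker = L.Ker φ

  Ker⊆derived : ∀ h {x} → Ker (suc h) x → Derived x
  Ker⊆derived zero (_ , φx≡𝟎) = ker⊆derived _ φx≡𝟎
  Ker⊆derived (suc h) (hx , _) = lcs⊆derived h hx

  -- [L•,L•] = ker L•(φ): in degree 1 both are K, in degree m ≥ 2 both are L_m
  span⊆Ker : ∀ {m x} → L.Span (suc m) x → Ker (suc m) x
  span⊆Ker {zero} s = LEq-degree1 _ , derived⊆ker _ (span⊆derived s)
  span⊆Ker {suc m} s = LEq-refl (suc (suc m)) (span⊆lcs s)

  Ker⊆span : ∀ {m x} → Ker (suc m) x → L.Span (suc m) x
  Ker⊆span {zero} (_ , φx≡𝟎) = derived⊆span (ker⊆derived _ φx≡𝟎)
  Ker⊆span {suc m} (hx , _) = lcs⊆span hx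

  -- a lift τ of a basis vector eᵢ is gᵢ up to d ∈ K, so τ² = [gᵢ,d] has degree 3
  basis-lift-square : ∀ τ i → φ τ ≡ e i → LCS 3 (τ ∙ τ)
  basis-lift-square τ i φτ≡eᵢ = resp (sym τ²≈) (lcs-commˡ 1 gᵢ (ker⊆derived _ φd≡𝟎))
    where
    gᵢ = g i
    d = τ ∙ gᵢ ⁻¹
    gᵢ⁻¹≈gᵢ : gᵢ ⁻¹ ≈ gᵢ
    gᵢ⁻¹≈gᵢ = sym (inverseʳ-unique gᵢ gᵢ (g-invol i))
    φd≡𝟎 : φ d ≡ 𝟎 n
    φd≡𝟎 = ≡.trans (φ-hom τ (gᵢ ⁻¹))
             (≡.trans (≡.cong₂ _⊕_ φτ≡eᵢ (≡.trans (φ-cong gᵢ⁻¹≈gᵢ) (φ-gen i))) (⊕-self (e i)))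
    hd : Derived d
    hd = ker⊆derived _ φd≡𝟎
    τ²≈ : τ ∙ τ ≈ ⟦ gᵢ , d ⟧
    τ²≈ = begin
      τ ∙ τ                       ≈⟨ groupLaw (τ ∷ gᵢ ∷ []) (x₀ · x₀) (((x₀ · x₁ ⁻) · conjₑ x₁ (x₀ · x₁ ⁻)) · (x₁ · x₁)) ≡.refl ⟩
      (d ∙ conj gᵢ d) ∙ (gᵢ ∙ gᵢ)  ≈⟨ ∙-congˡ (g-invol i) ⟩
      (d ∙ conj gᵢ d) ∙ ε         ≈⟨ identityʳ _ ⟩
      d ∙ conj gᵢ d               ≈⟨ derived-comm hd (lcs-conj 2 gᵢ hd) ⟩
      conj gᵢ d ∙ d               ≈⟨ comm≈conj∙ gᵢ hd ⟨
      ⟦ gᵢ , d ⟧                   ∎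
      where open import Relation.Binary.Reasoning.Setoid setoid

proposition3p3 : ∀ {c ℓ} (n : ℕ) (G : Group c ℓ)
    (φ : Group.Carrier G → V n) (g : Fin n → Group.Carrier G) →
    GroupDefs.IsNExpansionGroup G n φ g →
    LieDefs.IsNExpansionLieAlgebra (GroupDefs.LEq G) (Group._∙_ G) (Group.ε G)
      (GroupDefs.⟦_,_⟧ G) φ
proposition3p3 n G φ g ex = record
  { isGradedLieAlgebra = gradedLieAlgebra
  ; ψ-cong      = φ-cong₁
  ; ψ-hom       = λ {x} {y} _ _ → φ-hom x y
  ; ψ-surj      = φ-surj
  ; ker-abelian = λ {h} {k} kx ky →
      LEq-ε (suc h + suc k) (comm-of-derived (Ker⊆derived h kx) (Ker⊆derived k ky))
  ; derived⊆ker = span⊆Ker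
  ; ker⊆derived = Ker⊆span
  ; nest-perm   = λ j σ a b _ _ _ π →
      LEq-≈ (4 + j) (nest-lcs (2 + j) (λ s → σ (π ⟨$⟩ʳ s)) a b) (nest-permute (2 + j) σ a b π)
  ; nest-repeat = λ j σ a b _ _ _ s t s≢t (_ , _ , hst) →
      LEq-ε (4 + j) (nest-repeat (2 + j) σ a b s t s≢t hst)
  ; engel       = λ {τ} {y} _ _ (i , φτ≡eᵢ) → engel-of-square τ y (basis-lift-square τ i φτ≡eᵢ)
  }
  where
  open GroupDefs.IsNExpansionGroup ex using (φ-hom)
  open LowerCentralSeries G
  open ExpansionGroup n G φ g ex
  open ElementaryDerived G elementaryDerived
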